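{- Let $S=\frac{13591409}{545140134}$, $\varepsilon=53360^{ -3}$ and $s_k=\frac{(6k)!}{(3k)!\,(k!)^3}\cdot\frac{k+S}{640320^{3k}}$ for $k\ge0$. For all integers $n\ge1$ and $k\ge1$, $$\frac{s_{n+k}}{\varepsilon^k s_n}<1-\frac{k}{2n}+\frac{\frac38 k^2+\left(\frac{19}{72}-S\right)k}{n^2}+\frac{1.2\,k^6}{n^3}.$$ -}

module Defs where

import Data.Nat as ℕ
open import Data.Nat using (ℕ; _!) renaming (_*_ to _*ℕ_; _^_ to _^ℕ_; _+_ to _+ℕ_)
open import Data.Integer using (+_)
open import Data.Rational using (ℚ; 0ℚ; 1ℚ; _/_; _÷_; _+_; _*_; _-_; _≟_; ≢-nonZero)
open import Relation.Nullary using (yes; no)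

ι : ℕ → ℚ
ι n = (+ n) / 1

-- Total division on ℚ (x ÷ 0 := 0); only ever applied to nonzero divisors below.
_÷'_ : ℚ → ℚ → ℚ
x ÷' y with y ≟ 0ℚ
... | yes _ = 0ℚ
... | no y≢0 = _÷_ x y {{≢-nonZero y≢0}}

S : ℚ
S = ι 13591409 ÷' ι 545140134

ε : ℚ
ε = 1ℚ ÷' ι (53360 ^ℕ 3)

_^ℚ_ : ℚ → ℕ → ℚ
x ^ℚ ℕ.zero = 1ℚ
x ^ℚ ℕ.suc m = x * (x ^ℚ m)

ε^ : ℕ → ℚ
ε^ k = ε ^ℚ k

s : ℕ → ℚ
s k = (ι ((6 *ℕ k) !) ÷' ι (((3 *ℕ k) !) *ℕ ((k !) ^ℕ 3)))
      * ((ι k + S) ÷' ι (640320 ^ℕ (3 *ℕ k)))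

-- Write R(n,k) for the right-hand side, so that R(n,0) = 1, and prove
-- s(n+k) ≤ R(n,k) ε^k s(n) by induction on k, strictly once k ≥ 1.  With m = n + k,
-- consecutive terms satisfy 1728 b(m) (m+S) s(m+1) = ε a(m) (m+1+S) s(m), where
-- a(m) = (6m+1)⋯(6m+6), b(m) = (3m+1)(3m+2)(3m+3)(m+1)³ and 640320³ = 1728·53360³.
-- The induction step thus reduces to a(m) (m+1+S) R(n,k) < 1728 b(m) (m+S) R(n,k+1).
-- Multiplying by 360·D·n³ (clearing the denominators of R) and by D, where
-- S = N/D in lowest terms, turns it into an inequality between polynomials in n
-- and k with natural coefficients.  After substituting n = 1 + a, each coefficient
-- of 1 + the smaller side is bounded by the corresponding coefficient of the larger
-- side, which is checked by evaluation.

module Submission where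

open import Data.Bool.Base using (Bool; true; _∧_; T)
open import Data.Bool.Properties using (T-∧)
open import Data.List.Base using (List; []; _∷_)
open import Data.Maybe.Base using (just; nothing)
open import Data.Product.Base using (_,_)
open import Data.Unit.Base using (tt)
open import Function.Bundles using (Equivalence)
open import Level using (0ℓ)
open import Relation.Binary.PropositionalEquality
open import Relation.Nullary using (yes; no; contradiction)

-- Positivity of polynomials by comparison of coefficients

module _ where
  open import Data.Nat.Base
  open import Data.Nat.Properties
  open import Data.Nat.Tactic.RingSolver using (solve-∀)

  module Horner {Coeff : Set} (0# : Coeff) (_⊕_ _⊗_ : Coeff → Coeff → Coeff) (_≤ᶜ_ : Coeff → Coeff → Bool) where

    infixl 6 _+ᴾ_
    infixl 7 _*ᴾ_ _·ᴾ_

    _+ᴾ_ : List Coeff → List Coeff → List Coeff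
    []      +ᴾ q       = q
    (a ∷ p) +ᴾ []      = a ∷ p
    (a ∷ p) +ᴾ (b ∷ q) = (a ⊕ b) ∷ (p +ᴾ q)

    _·ᴾ_ : Coeff → List Coeff → List Coeff
    c ·ᴾ []      = []
    c ·ᴾ (a ∷ p) = (c ⊗ a) ∷ (c ·ᴾ p)

    _*ᴾ_ : List Coeff → List Coeff → List Coeff
    []      *ᴾ q = []
    (a ∷ p) *ᴾ q = a ·ᴾ q +ᴾ (0# ∷ p *ᴾ q)

    _≤ᴾ_ : List Coeff → List Coeff → Bool
    []      ≤ᴾ q       = true
    (a ∷ p) ≤ᴾ []      = (a ≤ᶜ 0#) ∧ (p ≤ᴾ [])
    (a ∷ p) ≤ᴾ (b ∷ q) = (a ≤ᶜ b) ∧ (p ≤ᴾ q)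

    module Semantics (⟦_⟧ᶜ : Coeff → ℕ)
                     (⟦0#⟧ : ⟦ 0# ⟧ᶜ ≡ 0)
                     (⟦⊕⟧ : ∀ a b → ⟦ a ⊕ b ⟧ᶜ ≡ ⟦ a ⟧ᶜ + ⟦ b ⟧ᶜ)
                     (⟦⊗⟧ : ∀ a b → ⟦ a ⊗ b ⟧ᶜ ≡ ⟦ a ⟧ᶜ * ⟦ b ⟧ᶜ)
                     (≤ᶜ-sound : ∀ a b → T (a ≤ᶜ b) → ⟦ a ⟧ᶜ ≤ ⟦ b ⟧ᶜ) where

      eval : List Coeff → ℕ → ℕ
      eval []      x = 0
      eval (c ∷ p) x = ⟦ c ⟧ᶜ + x * eval p x

      eval-+ᴾ : ∀ p q x → eval (p +ᴾ q) x ≡ eval p x + eval q x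
      eval-+ᴾ []      q       x = refl
      eval-+ᴾ (a ∷ p) []      x = sym (+-identityʳ _)
      eval-+ᴾ (a ∷ p) (b ∷ q) x rewrite ⟦⊕⟧ a b | eval-+ᴾ p q x = interchange ⟦ a ⟧ᶜ ⟦ b ⟧ᶜ x (eval p x) (eval q x)
        where
        interchange : ∀ a b x u v → a + b + x * (u + v) ≡ a + x * u + (b + x * v)
        interchange = solve-∀

      eval-·ᴾ : ∀ c p x → eval (c ·ᴾ p) x ≡ ⟦ c ⟧ᶜ * eval p x
      eval-·ᴾ c []      x = sym (*-zeroʳ ⟦ c ⟧ᶜ)
      eval-·ᴾ c (a ∷ p) x rewrite ⟦⊗⟧ c a | eval-·ᴾ c p x = sym (distribute ⟦ c ⟧ᶜ ⟦ a ⟧ᶜ x (eval p x))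
        where
        distribute : ∀ c a x u → c * (a + x * u) ≡ c * a + x * (c * u)
        distribute = solve-∀

      eval-*ᴾ : ∀ p q x → eval (p *ᴾ q) x ≡ eval p x * eval q x
      eval-*ᴾ []      q x = refl
      eval-*ᴾ (a ∷ p) q x = begin
        eval (a ·ᴾ q +ᴾ (0# ∷ p *ᴾ q)) x               ≡⟨ eval-+ᴾ (a ·ᴾ q) (0# ∷ p *ᴾ q) x ⟩
        eval (a ·ᴾ q) x + (⟦ 0# ⟧ᶜ + x * eval (p *ᴾ q) x) ≡⟨ cong₃ (eval-·ᴾ a q x) ⟦0#⟧ (eval-*ᴾ p q x) ⟩
        ⟦ a ⟧ᶜ * eval q x + (0 + x * (eval p x * eval q x)) ≡⟨ sym (distribute ⟦ a ⟧ᶜ x (eval p x) (eval q x)) ⟩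
        (⟦ a ⟧ᶜ + x * eval p x) * eval q x                ∎
        where
        open ≡-Reasoning
        cong₃ : ∀ {u u′ v v′ w w′} → u ≡ u′ → v ≡ v′ → w ≡ w′ → u + (v + x * w) ≡ u′ + (v′ + x * w′)
        cong₃ refl refl refl = refl
        distribute : ∀ a x u v → (a + x * u) * v ≡ a * v + (0 + x * (u * v))
        distribute = solve-∀

      ≤ᴾ-sound : ∀ p q x → T (p ≤ᴾ q) → eval p x ≤ eval q x
      ≤ᴾ-sound []      q       x _ = z≤n
      ≤ᴾ-sound (a ∷ p) []      x t with a≤0 , p≤0 ← Equivalence.to T-∧ t = begin
        ⟦ a ⟧ᶜ + x * eval p x ≤⟨ +-mono-≤ (≤ᶜ-sound a 0# a≤0) (*-monoʳ-≤ x (≤ᴾ-sound p [] x p≤0)) ⟩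
        ⟦ 0# ⟧ᶜ + x * 0       ≡⟨ cong₂ _+_ ⟦0#⟧ (*-zeroʳ x) ⟩
        0                     ∎
        where open ≤-Reasoning
      ≤ᴾ-sound (a ∷ p) (b ∷ q) x t with a≤b , p≤q ← Equivalence.to T-∧ t =
        +-mono-≤ (≤ᶜ-sound a b a≤b) (*-monoʳ-≤ x (≤ᴾ-sound p q x p≤q))

  module ℕ[X] = Horner 0 _+_ _*_ _≤ᵇ_
  module ℕ[X]-eval = ℕ[X].Semantics (λ c → c) refl (λ _ _ → refl) (λ _ _ → refl) ≤ᵇ⇒≤
  module ℕ[X][Y] = Horner [] ℕ[X]._+ᴾ_ ℕ[X]._*ᴾ_ ℕ[X]._≤ᴾ_
  module ℕ[X][Y]-eval (x : ℕ) = ℕ[X][Y].Semantics (λ p → ℕ[X]-eval.eval p x) refl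
    (λ p q → ℕ[X]-eval.eval-+ᴾ p q x) (λ p q → ℕ[X]-eval.eval-*ᴾ p q x) (λ p q → ℕ[X]-eval.≤ᴾ-sound p q x)

  infixl 6 _⊕_
  infixl 7 _⊗_
  infixr 8 _^ₑ_

  data Expr : Set where
    `n `k   : Expr
    lit     : ℕ → Expr
    _⊕_ _⊗_ : Expr → Expr → Expr

  _^ₑ_ : Expr → ℕ → Expr
  e ^ₑ zero  = lit 1
  e ^ₑ suc j = e ⊗ e ^ₑ j

  ⟦_⟧ : Expr → ℕ → ℕ → ℕ
  ⟦ `n    ⟧ n k = n
  ⟦ `k    ⟧ n k = k
  ⟦ lit c ⟧ n k = c
  ⟦ e ⊕ f ⟧ n k = ⟦ e ⟧ n k + ⟦ f ⟧ n k
  ⟦ e ⊗ f ⟧ n k = ⟦ e ⟧ n k * ⟦ f ⟧ n k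

  shifted : Expr → List (List ℕ)
  shifted `n      = (1 ∷ []) ∷ (1 ∷ []) ∷ []
  shifted `k      = (0 ∷ 1 ∷ []) ∷ []
  shifted (lit c) = (c ∷ []) ∷ []
  shifted (e ⊕ f) = shifted e ℕ[X][Y].+ᴾ shifted f
  shifted (e ⊗ f) = shifted e ℕ[X][Y].*ᴾ shifted f

  eval-shifted : ∀ e a k → ℕ[X][Y]-eval.eval k (shifted e) a ≡ ⟦ e ⟧ (suc a) k
  eval-shifted `n      a k = n-shape k a
    where n-shape : ∀ k a → 1 + k * 0 + a * (1 + k * 0 + a * 0) ≡ suc a
          n-shape = solve-∀
  eval-shifted `k      a k = k-shape k a
    where k-shape : ∀ k a → 0 + k * (1 + k * 0) + a * 0 ≡ k
          k-shape = solve-∀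
  eval-shifted (lit c) a k = lit-shape c k a
    where lit-shape : ∀ c k a → c + k * 0 + a * 0 ≡ c
          lit-shape = solve-∀
  eval-shifted (e ⊕ f) a k = trans (ℕ[X][Y]-eval.eval-+ᴾ k (shifted e) (shifted f) a)
                                   (cong₂ _+_ (eval-shifted e a k) (eval-shifted f a k))
  eval-shifted (e ⊗ f) a k = trans (ℕ[X][Y]-eval.eval-*ᴾ k (shifted e) (shifted f) a)
                                   (cong₂ _*_ (eval-shifted e a k) (eval-shifted f a k))

  <-by-coefficients : ∀ e f → T (shifted (lit 1 ⊕ e) ℕ[X][Y].≤ᴾ shifted f) →
                      ∀ {n} k .{{_ : NonZero n}} → ⟦ e ⟧ n k < ⟦ f ⟧ n k
  <-by-coefficients e f t {suc a} k =
    subst₂ _≤_ (eval-shifted (lit 1 ⊕ e) a k) (eval-shifted f a k)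
           (ℕ[X][Y]-eval.≤ᴾ-sound k (shifted (lit 1 ⊕ e)) (shifted f) a t)

module _ where
  open import Data.Nat.Base
  open import Data.Nat.Properties
  open import Data.Nat.Tactic.RingSolver using (solve-∀)

  -- Opaque so that conversion checking never unfolds a product of these literals
  -- with an open term, which would take time linear in their value.
  opaque
    S-num S-den : ℕ
    S-num = 13591409
    S-den = 545140134

  A B C : ℕ → ℕ
  A m = (6 * m) !
  B m = (3 * m) ! * (m !) ^ 3
  C m = 640320 ^ (3 * m)

  a b : ℕ → ℕ
  a m = (1 + 6 * m) * (2 + 6 * m) * (3 + 6 * m) * (4 + 6 * m) * (5 + 6 * m) * (6 + 6 * m)
  b m = (1 + 3 * m) * (2 + 3 * m) * (3 + 3 * m) * (1 + m) ^ 3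

  A-suc : ∀ m → A (suc m) ≡ a m * A m
  A-suc m = trans (cong _! (*-suc 6 m)) (unfold-6 m ((6 * m) !))
    where
    unfold-6 : ∀ m F → (6 + 6 * m) * ((5 + 6 * m) * ((4 + 6 * m) * ((3 + 6 * m) * ((2 + 6 * m) * ((1 + 6 * m) * F)))))
                     ≡ (1 + 6 * m) * (2 + 6 * m) * (3 + 6 * m) * (4 + 6 * m) * (5 + 6 * m) * (6 + 6 * m) * F
    unfold-6 = solve-∀

  B-suc : ∀ m → B (suc m) ≡ b m * B m
  B-suc m = trans (cong (λ j → j ! * (suc m !) ^ 3) (*-suc 3 m)) (unfold-3 m ((3 * m) !) (m !))
    where
    unfold-3 : ∀ m x y → let z = (1 + m) * y in
               (3 + 3 * m) * ((2 + 3 * m) * ((1 + 3 * m) * x)) * (z * (z * (z * 1)))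
               ≡ (1 + 3 * m) * (2 + 3 * m) * (3 + 3 * m) * ((1 + m) * ((1 + m) * ((1 + m) * 1))) * (x * (y * (y * (y * 1))))
    unfold-3 = solve-∀

  C-suc : ∀ m → C (suc m) ≡ 640320 ^ 3 * C m
  C-suc m = trans (cong (640320 ^_) (*-suc 3 m)) (^-distribˡ-+-* 640320 3 (3 * m))

  B≢0 : ∀ m → NonZero (B m)
  B≢0 m = m*n≢0 _ _ {{(3 * m) !≢0}} {{m^n≢0 _ 3 {{m !≢0}}}}

  C≢0 : ∀ m → NonZero (C m)
  C≢0 m = m^n≢0 640320 (3 * m)

  b≢0 : ∀ m → NonZero (b m)
  b≢0 m = _

  G : ℕ → ℕ
  G n = 360 * S-den * n ^ 3

  P Q : ℕ → ℕ → ℕ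
  P n k = 360 * S-den * n ^ 3 + 135 * S-den * k ^ 2 * n + 95 * S-den * k * n + 432 * S-den * k ^ 6
  Q n k = 180 * S-den * k * n ^ 2 + 360 * S-num * k * n

  G-expr : Expr
  G-expr = lit 360 ⊗ lit S-den ⊗ `n ^ₑ 3

  P-expr Q-expr : Expr → Expr
  P-expr κ = lit 360 ⊗ lit S-den ⊗ `n ^ₑ 3 ⊕ lit 135 ⊗ lit S-den ⊗ κ ^ₑ 2 ⊗ `n
           ⊕ lit 95 ⊗ lit S-den ⊗ κ ⊗ `n ⊕ lit 432 ⊗ lit S-den ⊗ κ ^ₑ 6
  Q-expr κ = lit 180 ⊗ lit S-den ⊗ κ ⊗ `n ^ₑ 2 ⊕ lit 360 ⊗ lit S-num ⊗ κ ⊗ `n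

  certificate : ∀ {n} k .{{_ : NonZero n}} →
    let m = n + k; β = S-den * suc m + S-num; γ = S-den * m + S-num in
    a m * β * P n k + Q n (suc k) * (1728 * b m * γ) < P n (suc k) * (1728 * b m * γ) + a m * β * Q n k
  certificate = <-by-coefficients
      (a-expr ⊗ β-expr ⊗ P-expr `k ⊕ Q-expr (lit 1 ⊕ `k) ⊗ (lit 1728 ⊗ b-expr ⊗ γ-expr))
      (P-expr (lit 1 ⊕ `k) ⊗ (lit 1728 ⊗ b-expr ⊗ γ-expr) ⊕ a-expr ⊗ β-expr ⊗ Q-expr `k)
      by-evaluation
    where
    μ a-expr b-expr β-expr γ-expr : Expr
    μ      = `n ⊕ `k
    a-expr = (lit 1 ⊕ lit 6 ⊗ μ) ⊗ (lit 2 ⊕ lit 6 ⊗ μ) ⊗ (lit 3 ⊕ lit 6 ⊗ μ)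
           ⊗ (lit 4 ⊕ lit 6 ⊗ μ) ⊗ (lit 5 ⊕ lit 6 ⊗ μ) ⊗ (lit 6 ⊕ lit 6 ⊗ μ)
    b-expr = (lit 1 ⊕ lit 3 ⊗ μ) ⊗ (lit 2 ⊕ lit 3 ⊗ μ) ⊗ (lit 3 ⊕ lit 3 ⊗ μ) ⊗ (lit 1 ⊕ μ) ^ₑ 3
    β-expr = lit S-den ⊗ (lit 1 ⊕ μ) ⊕ lit S-num
    γ-expr = lit S-den ⊗ μ ⊕ lit S-num
    -- The stated type agrees with ⟦_⟧ of the two expressions by conversion; only the
    -- coefficient comparison itself needs the values of S-num and S-den.
    opaque
      unfolding S-num S-den
      by-evaluation : T (shifted (lit 1 ⊕ (a-expr ⊗ β-expr ⊗ P-expr `k ⊕ Q-expr (lit 1 ⊕ `k) ⊗ (lit 1728 ⊗ b-expr ⊗ γ-expr)))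
                           ℕ[X][Y].≤ᴾ shifted (P-expr (lit 1 ⊕ `k) ⊗ (lit 1728 ⊗ b-expr ⊗ γ-expr) ⊕ a-expr ⊗ β-expr ⊗ Q-expr `k))
      by-evaluation = tt

open import Defs
open import Data.Integer.Base using (+_; +0)
import Data.Integer.Base as ℤ
open import Data.Nat.Base as ℕ using (ℕ; zero; suc) renaming (_+_ to _+ℕ_; _*_ to _*ℕ_; _^_ to _^ℕ_)
import Data.Nat.Properties as ℕ
import Data.Integer.Properties as ℤ
import Data.Nat.Coprimality as Coprime
open import Data.Rational.Base using (ℚ; mkℚ; 0ℚ; 1ℚ; _+_; _*_; _-_; -_; _<_; _≤_; 1/_; NonZero; ≢-nonZero; positive)
open import Data.Rational.Properties
open import Tactic.RingSolver using (solve-∀)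
open import Tactic.RingSolver.Core.AlmostCommutativeRing using (AlmostCommutativeRing; fromCommutativeRing)

ℚ-ring : AlmostCommutativeRing 0ℓ 0ℓ
ℚ-ring = fromCommutativeRing +-*-commutativeRing λ { (mkℚ +0 0 _) → just refl ; _ → nothing }

ι-as-mkℚ : ∀ n → ι n ≡ mkℚ (+ n) 0 (Coprime.sym (Coprime.1-coprimeTo n))
ι-as-mkℚ n = normalize-coprime (Coprime.sym (Coprime.1-coprimeTo n))

ι-+ : ∀ m n → ι (m +ℕ n) ≡ ι m + ι n
ι-+ m n = trans (/-cong {+ (m +ℕ n)} {1} {+ m ℤ.* + 1 ℤ.+ + n ℤ.* + 1} {1} numerators refl)
                (sym (cong₂ _+_ (ι-as-mkℚ m) (ι-as-mkℚ n)))
  where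
  numerators : + (m +ℕ n) ≡ + m ℤ.* + 1 ℤ.+ + n ℤ.* + 1
  numerators = trans (ℤ.pos-+ m n) (sym (cong₂ ℤ._+_ (ℤ.*-identityʳ (+ m)) (ℤ.*-identityʳ (+ n))))

ι-* : ∀ m n → ι (m *ℕ n) ≡ ι m * ι n
ι-* m n = trans (/-cong {+ (m *ℕ n)} {1} {+ m ℤ.* + n} {1} (ℤ.pos-* m n) refl)
                (sym (cong₂ _*_ (ι-as-mkℚ m) (ι-as-mkℚ n)))

ι-pos : ∀ n .{{_ : ℕ.NonZero n}} → 0ℚ < ι n
ι-pos n = positive⁻¹ (ι n) {{normalize-pos n 1}}

ι-nonNeg : ∀ n → 0ℚ ≤ ι n
ι-nonNeg n = nonNegative⁻¹ (ι n) {{normalize-nonNeg n 1}}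

pos⇒≢0 : ∀ {x} → 0ℚ < x → x ≢ 0ℚ
pos⇒≢0 x>0 x≡0 = <-irrefl (sym x≡0) x>0

ι≢0 : ∀ n .{{_ : ℕ.NonZero n}} → ι n ≢ 0ℚ
ι≢0 n = pos⇒≢0 (ι-pos n)

ι-mono-< : ∀ {m n} → m ℕ.< n → ι m < ι n
ι-mono-< {m} {n} m<n = begin-strict
  ι m                  ≡⟨ +-identityʳ (ι m) ⟨
  ι m + 0ℚ             <⟨ +-monoʳ-< (ι m) (ι-pos (n ℕ.∸ m) {{ℕ.>-nonZero (ℕ.m<n⇒0<n∸m m<n)}}) ⟩
  ι m + ι (n ℕ.∸ m)    ≡⟨ ι-+ m (n ℕ.∸ m) ⟨
  ι (m +ℕ (n ℕ.∸ m))   ≡⟨ cong ι (ℕ.m+[n∸m]≡n (ℕ.<⇒≤ m<n)) ⟩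
  ι n                  ∎
  where open ≤-Reasoning

*-pos : ∀ {x y} → 0ℚ < x → 0ℚ < y → 0ℚ < x * y
*-pos {x} {y} x>0 y>0 = positive⁻¹ (x * y) {{pos*pos⇒pos x {{positive x>0}} y {{positive y>0}}}}

*-cancelʳ-< : ∀ {r p q} → 0ℚ < r → p * r < q * r → p < q
*-cancelʳ-< {r} r>0 = *-cancelʳ-<-nonNeg r {{pos⇒nonNeg r {{positive r>0}}}}

*-pos-cancelʳ : ∀ {x y} → 0ℚ < y → 0ℚ < x * y → 0ℚ < x
*-pos-cancelʳ {x} {y} y>0 xy>0 = *-cancelʳ-< y>0 (subst (_< x * y) (sym (*-zeroˡ y)) xy>0)

*-cancelʳ-≡ : ∀ {x y z} → z ≢ 0ℚ → x * z ≡ y * z → x ≡ y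
*-cancelʳ-≡ {x} {y} {z} z≢0 xz≡yz = begin
  x                ≡⟨ *-identityʳ x ⟨
  x * 1ℚ           ≡⟨ cong (x *_) (*-inverseʳ z) ⟨
  x * (z * 1/ z)   ≡⟨ *-assoc x z (1/ z) ⟨
  x * z * 1/ z     ≡⟨ cong (_* 1/ z) xz≡yz ⟩
  y * z * 1/ z     ≡⟨ *-assoc y z (1/ z) ⟩
  y * (z * 1/ z)   ≡⟨ cong (y *_) (*-inverseʳ z) ⟩
  y * 1ℚ           ≡⟨ *-identityʳ y ⟩
  y                ∎
  where
  open ≡-Reasoning
  instance
    z-nonZero : NonZero z
    z-nonZero = ≢-nonZero z≢0

x÷'y*y≡x : ∀ x y → y ≢ 0ℚ → (x ÷' y) * y ≡ x
x÷'y*y≡x x y y≢0 with y ≟ 0ℚ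
... | yes y≡0 = contradiction y≡0 y≢0
... | no y≢0′ = begin
  x * 1/ y * y     ≡⟨ *-assoc x (1/ y) y ⟩
  x * (1/ y * y)   ≡⟨ cong (x *_) (*-inverseˡ y) ⟩
  x * 1ℚ           ≡⟨ *-identityʳ x ⟩
  x                ∎
  where
  open ≡-Reasoning
  instance
    y-nonZero : NonZero y
    y-nonZero = ≢-nonZero y≢0′

x<z*y⇒x÷'y<z : ∀ {x y z} → 0ℚ < y → x < z * y → x ÷' y < z
x<z*y⇒x÷'y<z {x} {y} {z} y>0 x<zy =
  *-cancelʳ-< y>0 (subst (_< z * y) (sym (x÷'y*y≡x x y (pos⇒≢0 y>0))) x<zy)

0÷'y≡0 : ∀ y → 0ℚ ÷' y ≡ 0ℚ
0÷'y≡0 y with y ≟ 0ℚ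
... | yes _   = refl
... | no y≢0 = *-zeroˡ (1/_ y {{≢-nonZero y≢0}})

x+y<w+z⇒x-z<w-y : ∀ {x y w z} → x + y < w + z → x - z < w - y
x+y<w+z⇒x-z<w-y {x} {y} {w} {z} lt = subst₂ _<_ (cancel-y x y z) (cancel-z w y z) (+-monoˡ-< (- (y + z)) lt)
  where
  cancel-y : ∀ x y z → x + y + - (y + z) ≡ x - z
  cancel-y = solve-∀ ℚ-ring
  cancel-z : ∀ w y z → w + z + - (y + z) ≡ w - y
  cancel-z = solve-∀ ℚ-ring

⟦_⟧ℚ : Expr → ℚ → ℚ → ℚ
⟦ `n    ⟧ℚ N K = N
⟦ `k    ⟧ℚ N K = K
⟦ lit c ⟧ℚ N K = ι c
⟦ e ⊕ f ⟧ℚ N K = ⟦ e ⟧ℚ N K + ⟦ f ⟧ℚ N K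
⟦ e ⊗ f ⟧ℚ N K = ⟦ e ⟧ℚ N K * ⟦ f ⟧ℚ N K

ι-⟦⟧ : ∀ e n k → ι (⟦ e ⟧ n k) ≡ ⟦ e ⟧ℚ (ι n) (ι k)
ι-⟦⟧ `n      n k = refl
ι-⟦⟧ `k      n k = refl
ι-⟦⟧ (lit c) n k = refl
ι-⟦⟧ (e ⊕ f) n k = trans (ι-+ (⟦ e ⟧ n k) (⟦ f ⟧ n k)) (cong₂ _+_ (ι-⟦⟧ e n k) (ι-⟦⟧ f n k))
ι-⟦⟧ (e ⊗ f) n k = trans (ι-* (⟦ e ⟧ n k) (⟦ f ⟧ n k)) (cong₂ _*_ (ι-⟦⟧ e n k) (ι-⟦⟧ f n k))

opaque
  unfolding S-num S-den

  S*S-den≡S-num : S * ι S-den ≡ ι S-num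
  S*S-den≡S-num = refl

  S-den≢0 : ℕ.NonZero S-den
  S-den≢0 = _

S-pos : 0ℚ < S
S-pos = positive⁻¹ S

ε-pos : 0ℚ < ε
ε-pos = positive⁻¹ ε

ε*640320³≡1728 : ε * ι (640320 ^ℕ 3) ≡ ι 1728
ε*640320³≡1728 = refl

ε^-pos : ∀ k → 0ℚ < ε^ k
ε^-pos zero    = positive⁻¹ 1ℚ
ε^-pos (suc k) = *-pos ε-pos (ε^-pos k)

ι+S-pos : ∀ m → 0ℚ < ι m + S
ι+S-pos m = subst (_< ι m + S) (+-identityˡ 0ℚ) (+-mono-≤-< (ι-nonNeg m) S-pos)

s-cleared : ∀ m → s m * (ι (B m) * ι (C m)) ≡ ι (A m) * (ι m + S)
s-cleared m = trans (interchange (ι (A m) ÷' ι (B m)) ((ι m + S) ÷' ι (C m)) (ι (B m)) (ι (C m)))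
                    (cong₂ _*_ (x÷'y*y≡x (ι (A m)) (ι (B m)) (ι≢0 (B m) {{B≢0 m}}))
                               (x÷'y*y≡x (ι m + S) (ι (C m)) (ι≢0 (C m) {{C≢0 m}})))
  where
  interchange : ∀ u v y z → u * v * (y * z) ≡ u * y * (v * z)
  interchange = solve-∀ ℚ-ring

BC-pos : ∀ m → 0ℚ < ι (B m) * ι (C m)
BC-pos m = *-pos (ι-pos (B m) {{B≢0 m}}) (ι-pos (C m) {{C≢0 m}})

s-pos : ∀ m → 0ℚ < s m
s-pos m = *-pos-cancelʳ (BC-pos m)
            (subst (0ℚ <_) (sym (s-cleared m)) (*-pos (ι-pos (A m) {{(6 *ℕ m) ℕ.!≢0}}) (ι+S-pos m)))

s-ratio : ∀ m → s (suc m) * (ι 1728 * ι (b m) * (ι m + S)) ≡ ε * (ι (a m) * (ι (suc m) + S)) * s m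
s-ratio m = *-cancelʳ-≡ (pos⇒≢0 (BC-pos m)) (begin
  s′ * (ι 1728 * ι (b m) * u) * (ι (B m) * ι (C m))
    ≡⟨ cong (λ c → s′ * (c * ι (b m) * u) * (ι (B m) * ι (C m))) ε*640320³≡1728 ⟨
  s′ * (ε * ι K * ι (b m) * u) * (ι (B m) * ι (C m))
    ≡⟨ regroup s′ ε (ι K) (ι (b m)) u (ι (B m)) (ι (C m)) ⟩
  ε * u * (s′ * (ι (b m) * ι (B m) * (ι K * ι (C m))))
    ≡⟨ cong (λ z → ε * u * (s′ * z)) (cong₂ _*_ ι-B-suc ι-C-suc) ⟨
  ε * u * (s′ * (ι (B (suc m)) * ι (C (suc m))))
    ≡⟨ cong (ε * u *_) (s-cleared (suc m)) ⟩
  ε * u * (ι (A (suc m)) * u′)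
    ≡⟨ cong (λ z → ε * u * (z * u′)) ι-A-suc ⟩
  ε * u * (ι (a m) * ι (A m) * u′)
    ≡⟨ regroup′ ε u (ι (a m)) (ι (A m)) u′ ⟩
  ε * (ι (a m) * u′) * (ι (A m) * u)
    ≡⟨ cong (ε * (ι (a m) * u′) *_) (s-cleared m) ⟨
  ε * (ι (a m) * u′) * (s m * (ι (B m) * ι (C m)))
    ≡⟨ *-assoc (ε * (ι (a m) * u′)) (s m) (ι (B m) * ι (C m)) ⟨
  ε * (ι (a m) * u′) * s m * (ι (B m) * ι (C m)) ∎)
  where
  open ≡-Reasoning
  K = 640320 ^ℕ 3
  s′ = s (suc m)
  u = ι m + S
  u′ = ι (suc m) + S
  ι-A-suc : ι (A (suc m)) ≡ ι (a m) * ι (A m)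
  ι-A-suc = trans (cong ι (A-suc m)) (ι-* (a m) (A m))
  ι-B-suc : ι (B (suc m)) ≡ ι (b m) * ι (B m)
  ι-B-suc = trans (cong ι (B-suc m)) (ι-* (b m) (B m))
  ι-C-suc : ι (C (suc m)) ≡ ι K * ι (C m)
  ι-C-suc = trans (cong ι (C-suc m)) (ι-* K (C m))
  regroup : ∀ s′ ε c b u y z → s′ * (ε * c * b * u) * (y * z) ≡ ε * u * (s′ * (b * y * (c * z)))
  regroup = solve-∀ ℚ-ring
  regroup′ : ∀ ε u a x u′ → ε * u * (a * x * u′) ≡ ε * (a * u′) * (x * u)
  regroup′ = solve-∀ ℚ-ring

-- The bound and the induction

bound : ℕ → ℕ → ℚ
bound n k = ((1ℚ - (ι k ÷' ι (2 *ℕ n)))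
            + (((ι 3 ÷' ι 8) * ι (k ^ℕ 2) + ((ι 19 ÷' ι 72) - S) * ι k) ÷' ι (n ^ℕ 2)))
            + (((ι 6 ÷' ι 5) * ι (k ^ℕ 6)) ÷' ι (n ^ℕ 3))

bound-zero : ∀ n → bound n 0 ≡ 1ℚ
bound-zero n = cong₂ _+_ (cong₂ _+_ (cong (λ x → 1ℚ - x) (0÷'y≡0 (ι (2 *ℕ n)))) (0÷'y≡0 (ι (n ^ℕ 2))))
                         (0÷'y≡0 (ι (n ^ℕ 3)))

bound-cleared : ∀ {n} k .{{_ : ℕ.NonZero n}} → bound n k * ι (G n) ≡ ι (P n k) - ι (Q n k)
bound-cleared {n} k = begin
  bound n k * ι (G n)
    ≡⟨ cong (bound n k *_) (ι-⟦⟧ G-expr n k) ⟩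
  (1ℚ - d₁ + d₂ + d₃) * (ι 360 * δ * N³)
    ≡⟨ expand d₁ d₂ d₃ N δ ⟩
  cleared (d₁ * (ι 2 * N)) (d₂ * N²) (d₃ * N³)
    ≡⟨ cong₃ d₁-cleared d₂-cleared d₃-cleared ⟩
  cleared K (c₁ * K² + (c₂ - S) * K) (c₃ * K⁶)
    ≡⟨ collect c₁ c₂ c₃ S δ N K ⟩
  ι 360 * δ * N³ + c₁ * ι 360 * δ * K² * N + c₂ * ι 360 * δ * K * N + c₃ * ι 360 * δ * K⁶
    - (ι 180 * δ * K * N² + ι 360 * (S * δ) * K * N)
    -- c₁ * ι 360, c₂ * ι 360 and c₃ * ι 360 evaluate to ι 135, ι 95 and ι 432
    ≡⟨ cong (λ ν → ι 360 * δ * N³ + c₁ * ι 360 * δ * K² * N + c₂ * ι 360 * δ * K * N + c₃ * ι 360 * δ * K⁶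
                    - (ι 180 * δ * K * N² + ι 360 * ν * K * N)) S*S-den≡S-num ⟩
  ⟦ P-expr `k ⟧ℚ N K - ⟦ Q-expr `k ⟧ℚ N K
    ≡⟨ cong₂ _-_ (ι-⟦⟧ (P-expr `k) n k) (ι-⟦⟧ (Q-expr `k) n k) ⟨
  ι (P n k) - ι (Q n k) ∎
  where
  open ≡-Reasoning
  N = ι n
  K = ι k
  δ = ι S-den
  N² = N * (N * ι 1)
  N³ = N * (N * (N * ι 1))
  K² = K * (K * ι 1)
  K⁶ = K * (K * (K * (K * (K * (K * ι 1)))))
  c₁ = ι 3 ÷' ι 8
  c₂ = ι 19 ÷' ι 72
  c₃ = ι 6 ÷' ι 5
  d₁ = K ÷' ι (2 *ℕ n)
  d₂ = (c₁ * ι (k ^ℕ 2) + (c₂ - S) * K) ÷' ι (n ^ℕ 2)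
  d₃ = (c₃ * ι (k ^ℕ 6)) ÷' ι (n ^ℕ 3)

  cleared : ℚ → ℚ → ℚ → ℚ
  cleared x y z = ι 360 * δ * N³ - ι 180 * δ * (N * N) * x + ι 360 * δ * N * y + ι 360 * δ * z

  cong₃ : ∀ {x x′ y y′ z z′} → x ≡ x′ → y ≡ y′ → z ≡ z′ → cleared x y z ≡ cleared x′ y′ z′
  cong₃ refl refl refl = refl

  d₁-cleared : d₁ * (ι 2 * N) ≡ K
  d₁-cleared = trans (cong (d₁ *_) (sym (ι-* 2 n))) (x÷'y*y≡x K (ι (2 *ℕ n)) (ι≢0 (2 *ℕ n) {{ℕ.m*n≢0 2 n}}))

  d₂-cleared : d₂ * N² ≡ c₁ * K² + (c₂ - S) * K
  d₂-cleared = begin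
    d₂ * N²                              ≡⟨ cong (d₂ *_) (ι-⟦⟧ (`n ^ₑ 2) n k) ⟨
    d₂ * ι (n ^ℕ 2)                      ≡⟨ x÷'y*y≡x _ (ι (n ^ℕ 2)) (ι≢0 (n ^ℕ 2) {{ℕ.m^n≢0 n 2}}) ⟩
    c₁ * ι (k ^ℕ 2) + (c₂ - S) * K       ≡⟨ cong (λ t → c₁ * t + (c₂ - S) * K) (ι-⟦⟧ (`k ^ₑ 2) n k) ⟩
    c₁ * K² + (c₂ - S) * K               ∎

  d₃-cleared : d₃ * N³ ≡ c₃ * K⁶
  d₃-cleared = begin
    d₃ * N³                              ≡⟨ cong (d₃ *_) (ι-⟦⟧ (`n ^ₑ 3) n k) ⟨
    d₃ * ι (n ^ℕ 3)                      ≡⟨ x÷'y*y≡x _ (ι (n ^ℕ 3)) (ι≢0 (n ^ℕ 3) {{ℕ.m^n≢0 n 3}}) ⟩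
    c₃ * ι (k ^ℕ 6)                      ≡⟨ cong (c₃ *_) (ι-⟦⟧ (`k ^ₑ 6) n k) ⟩
    c₃ * K⁶                              ∎

  expand : ∀ d₁ d₂ d₃ N δ →
    (1ℚ - d₁ + d₂ + d₃) * (ι 360 * δ * (N * (N * (N * ι 1))))
    ≡ ι 360 * δ * (N * (N * (N * ι 1))) - ι 180 * δ * (N * N) * (d₁ * (ι 2 * N))
      + ι 360 * δ * N * (d₂ * (N * (N * ι 1))) + ι 360 * δ * (d₃ * (N * (N * (N * ι 1))))
  expand = solve-∀ ℚ-ring

  collect : ∀ c₁ c₂ c₃ σ δ N K →
    ι 360 * δ * (N * (N * (N * ι 1))) - ι 180 * δ * (N * N) * K
      + ι 360 * δ * N * (c₁ * (K * (K * ι 1)) + (c₂ - σ) * K) + ι 360 * δ * (c₃ * (K * (K * (K * (K * (K * (K * ι 1)))))))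
    ≡ ι 360 * δ * (N * (N * (N * ι 1))) + c₁ * ι 360 * δ * (K * (K * ι 1)) * N + c₂ * ι 360 * δ * K * N
      + c₃ * ι 360 * δ * (K * (K * (K * (K * (K * (K * ι 1)))))) - (ι 180 * δ * K * (N * (N * ι 1)) + ι 360 * (σ * δ) * K * N)
  collect = solve-∀ ℚ-ring

shift-cleared : ∀ x → (ι x + S) * ι S-den ≡ ι (S-den *ℕ x +ℕ S-num)
shift-cleared x = begin
  (ι x + S) * ι S-den               ≡⟨ *-distribʳ-+ (ι S-den) (ι x) S ⟩
  ι x * ι S-den + S * ι S-den       ≡⟨ cong₂ _+_ (*-comm (ι x) (ι S-den)) S*S-den≡S-num ⟩
  ι S-den * ι x + ι S-num           ≡⟨ cong (_+ ι S-num) (ι-* S-den x) ⟨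
  ι (S-den *ℕ x) + ι S-num          ≡⟨ ι-+ (S-den *ℕ x) S-num ⟨
  ι (S-den *ℕ x +ℕ S-num)           ∎
  where open ≡-Reasoning

cross-multiplied : ∀ {x y p₀ q₀ p₁ q₁} → x *ℕ p₀ +ℕ q₁ *ℕ y ℕ.< p₁ *ℕ y +ℕ x *ℕ q₀ →
                   ι x * (ι p₀ - ι q₀) < (ι p₁ - ι q₁) * ι y
cross-multiplied {x} {y} {p₀} {q₀} {p₁} {q₁} lt = begin-strict
  ι x * (ι p₀ - ι q₀)          ≡⟨ distribˡ (ι x) (ι p₀) (ι q₀) ⟩
  ι x * ι p₀ - ι x * ι q₀      <⟨ x+y<w+z⇒x-z<w-y {ι x * ι p₀} {ι q₁ * ι y} {ι p₁ * ι y} {ι x * ι q₀} lt-in-ℚ ⟩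
  ι p₁ * ι y - ι q₁ * ι y      ≡⟨ distribʳ (ι y) (ι p₁) (ι q₁) ⟨
  (ι p₁ - ι q₁) * ι y          ∎
  where
  open ≤-Reasoning
  ι-+-* : ∀ a b c d → ι (a *ℕ b +ℕ c *ℕ d) ≡ ι a * ι b + ι c * ι d
  ι-+-* a b c d = trans (ι-+ (a *ℕ b) (c *ℕ d)) (cong₂ _+_ (ι-* a b) (ι-* c d))
  lt-in-ℚ : ι x * ι p₀ + ι q₁ * ι y < ι p₁ * ι y + ι x * ι q₀
  lt-in-ℚ = subst₂ _<_ (ι-+-* x p₀ q₁ y) (ι-+-* p₁ y x q₀) (ι-mono-< lt)
  distribˡ : ∀ x p q → x * (p - q) ≡ x * p - x * q
  distribˡ = solve-∀ ℚ-ring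
  distribʳ : ∀ y p q → (p - q) * y ≡ p * y - q * y
  distribʳ = solve-∀ ℚ-ring

bound-step : ∀ {n} k .{{_ : ℕ.NonZero n}} → let m = n +ℕ k in
  ι (a m) * (ι (suc m) + S) * bound n k < bound n (suc k) * (ι 1728 * ι (b m) * (ι m + S))
bound-step {n} k = *-cancelʳ-< W-pos (begin-strict
  ι (a m) * (ι (suc m) + S) * bound n k * W
    ≡⟨ regroup (ι (a m)) (ι (suc m) + S) (bound n k) (ι (G n)) (ι S-den) ⟩
  ι (a m) * ((ι (suc m) + S) * ι S-den) * (bound n k * ι (G n))
    ≡⟨ cong₂ (λ u v → ι (a m) * u * v) (shift-cleared (suc m)) (bound-cleared k) ⟩
  ι (a m) * ι β * (ι (P n k) - ι (Q n k))
    ≡⟨ cong (_* (ι (P n k) - ι (Q n k))) (ι-* (a m) β) ⟨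
  ι (a m *ℕ β) * (ι (P n k) - ι (Q n k))
    <⟨ cross-multiplied {a m *ℕ β} {1728 *ℕ b m *ℕ γ} {P n k} {Q n k} {P n (suc k)} {Q n (suc k)}
                        (certificate k) ⟩
  (ι (P n (suc k)) - ι (Q n (suc k))) * ι (1728 *ℕ b m *ℕ γ)
    ≡⟨ cong₂ _*_ (bound-cleared (suc k)) (sym ι-1728bγ) ⟨
  bound n (suc k) * ι (G n) * (ι 1728 * ι (b m) * ι γ)
    ≡⟨ cong (λ v → bound n (suc k) * ι (G n) * (ι 1728 * ι (b m) * v)) (shift-cleared m) ⟨
  bound n (suc k) * ι (G n) * (ι 1728 * ι (b m) * ((ι m + S) * ι S-den))
    ≡⟨ regroup′ (bound n (suc k)) (ι (G n)) (ι 1728 * ι (b m)) (ι m + S) (ι S-den) ⟩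
  bound n (suc k) * (ι 1728 * ι (b m) * (ι m + S)) * W ∎)
  where
  open ≤-Reasoning
  m = n +ℕ k
  β = S-den *ℕ suc m +ℕ S-num
  γ = S-den *ℕ m +ℕ S-num
  W = ι (G n) * ι S-den
  W-pos : 0ℚ < W
  W-pos = *-pos (ι-pos (G n) {{ℕ.m*n≢0 _ _ {{ℕ.m*n≢0 360 S-den {{_}} {{S-den≢0}}}} {{ℕ.m^n≢0 n 3}}}})
                (ι-pos S-den {{S-den≢0}})
  ι-1728bγ : ι (1728 *ℕ b m *ℕ γ) ≡ ι 1728 * ι (b m) * ι γ
  ι-1728bγ = trans (ι-* (1728 *ℕ b m) γ) (cong (_* ι γ) (ι-* 1728 (b m)))
  regroup : ∀ α u r g δ → α * u * r * (g * δ) ≡ α * (u * δ) * (r * g)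
  regroup = solve-∀ ℚ-ring
  regroup′ : ∀ r g c u δ → r * g * (c * (u * δ)) ≡ r * (c * u) * (g * δ)
  regroup′ = solve-∀ ℚ-ring

s-bound-step : ∀ {n} k .{{_ : ℕ.NonZero n}} →
  s (n +ℕ k) ≤ bound n k * (ε^ k * s n) → s (n +ℕ suc k) < bound n (suc k) * (ε^ (suc k) * s n)
s-bound-step {n} k ih = subst (λ j → s j < bound n (suc k) * (ε^ (suc k) * s n)) (sym (ℕ.+-suc n k))
  (*-cancelʳ-< W-pos (begin-strict
    s (suc m) * W                             ≡⟨ s-ratio m ⟩
    ε * c * s m                               ≤⟨ *-monoˡ-≤-nonNeg (ε * c) {{pos⇒nonNeg (ε * c) {{positive εc-pos}}}} ih ⟩
    ε * c * (bound n k * Y)                   ≡⟨ regroup ε c (bound n k) Y ⟩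
    ε * Y * (c * bound n k)                   <⟨ *-monoʳ-<-pos (ε * Y) {{positive εY-pos}} (bound-step k) ⟩
    ε * Y * (bound n (suc k) * W)             ≡⟨ regroup′ ε (ε^ k) (s n) (bound n (suc k)) W ⟩
    bound n (suc k) * (ε^ (suc k) * s n) * W  ∎))
  where
  open ≤-Reasoning
  m = n +ℕ k
  c = ι (a m) * (ι (suc m) + S)
  Y = ε^ k * s n
  W = ι 1728 * ι (b m) * (ι m + S)
  W-pos : 0ℚ < W
  W-pos = *-pos (*-pos (ι-pos 1728) (ι-pos (b m) {{b≢0 m}})) (ι+S-pos m)
  εc-pos : 0ℚ < ε * c
  εc-pos = *-pos ε-pos (*-pos (ι-pos (a m)) (ι+S-pos (suc m)))
  εY-pos : 0ℚ < ε * Y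
  εY-pos = *-pos ε-pos (*-pos (ε^-pos k) (s-pos n))
  regroup : ∀ ε c r Y → ε * c * (r * Y) ≡ ε * Y * (c * r)
  regroup = solve-∀ ℚ-ring
  regroup′ : ∀ ε e σ r W → ε * (e * σ) * (r * W) ≡ r * (ε * e * σ) * W
  regroup′ = solve-∀ ℚ-ring

s-bound : ∀ {n} k .{{_ : ℕ.NonZero n}} → s (n +ℕ k) ≤ bound n k * (ε^ k * s n)
s-bound {n} zero    = ≤-reflexive (begin
  s (n +ℕ 0)                ≡⟨ cong s (ℕ.+-identityʳ n) ⟩
  s n                       ≡⟨ *-identityˡ (s n) ⟨
  ε^ 0 * s n                ≡⟨ *-identityˡ (ε^ 0 * s n) ⟨
  1ℚ * (ε^ 0 * s n)         ≡⟨ cong (_* (ε^ 0 * s n)) (bound-zero n) ⟨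
  bound n 0 * (ε^ 0 * s n)  ∎)
  where open ≡-Reasoning
s-bound {n} (suc k) = <⇒≤ (s-bound-step {n} k (s-bound k))

lemma2 : (n k : ℕ) → n ℕ.≥ 1 → k ℕ.≥ 1 →
    (s (n +ℕ k) ÷' (ε^ k * s n))
      < ((1ℚ - (ι k ÷' ι (2 *ℕ n)))
         + (((ι 3 ÷' ι 8) * ι (k ^ℕ 2) + ((ι 19 ÷' ι 72) - S) * ι k) ÷' ι (n ^ℕ 2)))
         + (((ι 6 ÷' ι 5) * ι (k ^ℕ 6)) ÷' ι (n ^ℕ 3))
lemma2 (suc n) (suc k) _ _ =
  x<z*y⇒x÷'y<z {s (suc n +ℕ suc k)} {ε^ (suc k) * s (suc n)} {bound (suc n) (suc k)}
    (*-pos (ε^-pos (suc k)) (s-pos (suc n))) (s-bound-step {suc n} k (s-bound {suc n} k))
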